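{- Let $(G,\Sigma)$ be obtained from $W_4^o$ by adding an odd or an even edge between two nonadjacent vertices. Then $(G,\Sigma)$ has a weak $K_4^o$-minor or a weak $K_4^e$-minor.
   Context: A signed graph is a pair $(G,\Sigma)$ where $G$ is a finite graph (parallel edges allowed, no loops) and $\Sigma\subseteq E(G)$; edges in $\Sigma$ are odd, the others even. Re-signing on $U\subseteq V(G)$ replaces $\Sigma$ by $\Sigma\,\Delta\,\delta(U)$, $\delta(U)$ being the set of edges with exactly one end in $U$. A weak minor of $(G,\Sigma)$ is a signed graph obtained by deleting edges and vertices, contracting edges (of any parity), and re-signing around vertices. $K_4^e=(K_4,\emptyset)$, $K_4^o=(K_4,E(K_4))$. $W_4$ is the graph obtained from a 4-cycle (the rim) by adding a new vertex adjacent to all rim vertices; $W_4^o=(W_4,\{e_1,e_2\})$ where $e_1,e_2$ are two nonadjacent edges of the rim. -}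

module Defs where

open import Data.Nat using (ℕ; zero; suc)
open import Data.Fin using (Fin; zero; suc; punchOut; _≟_)
open import Data.Bool using (Bool; true; false; _xor_; _∧_; _∨_; not)
open import Data.List using (List; []; _∷_; map; length; removeAt)
open import Data.List.Membership.Propositional using (_∈_)
open import Data.Sum using (_⊎_)
open import Data.Product using (Σ; _×_; _,_; ∃)
open import Relation.Nullary using (¬_; yes; no)
open import Relation.Nullary.Decidable using (⌊_⌋)
open import Relation.Binary.PropositionalEquality using (_≡_; _≢_; sym)
open import Relation.Binary.Construct.Closure.ReflexiveTransitive using (Star)
open import Function.Bundles using (_↔_; Inverse)

-- An edge is a triple (u , v , s)
-- with ends u, v and sign s; s = true means the edge is ODD (in Σ),
-- s = false means EVEN.  Parallel edges are allowed (the edge list is a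
-- multiset).  Loops are never produced: the graphs we start from are
-- loopless, and contraction deletes the edges that would become loops.

Edge : ℕ → Set
Edge n = Fin n × Fin n × Bool

record SGraph : Set where
  constructor sg
  field
    nv    : ℕ
    edges : List (Edge nv)
open SGraph public

delVertexEdges : ∀ {k} (v : Fin (suc k)) → List (Edge (suc k)) → List (Edge k)
delVertexEdges v [] = []
delVertexEdges v ((a , b , s) ∷ es) with v ≟ a | v ≟ b
... | no v≢a | no v≢b = (punchOut v≢a , punchOut v≢b , s) ∷ delVertexEdges v es
... | _      | _      = delVertexEdges v es

-- image of vertex x when vertex b is identified into vertex a (a ≢ b)
mergeV : ∀ {k} (a b : Fin (suc k)) → a ≢ b → Fin (suc k) → Fin k
mergeV a b a≢b x with b ≟ x
... | yes _   = punchOut {i = b} {j = a} (λ b≡a → a≢b (sym b≡a))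
... | no b≢x  = punchOut b≢x

isEnd : ∀ {n} → Fin n → Fin n → Fin n → Bool
isEnd a b x = ⌊ x ≟ a ⌋ ∨ ⌊ x ≟ b ⌋

-- contract (an edge with ends) a, b: identify b into a; every edge with both
-- ends in {a,b} (the contracted edge and its parallels) would become a loop
-- and is deleted; all other edges keep their sign (contraction of any parity).
contractEdges : ∀ {k} (a b : Fin (suc k)) → a ≢ b →
                List (Edge (suc k)) → List (Edge k)
contractEdges a b a≢b [] = []
contractEdges a b a≢b ((x , y , s) ∷ es) with isEnd a b x ∧ isEnd a b y
... | true  = contractEdges a b a≢b es
... | false = (mergeV a b a≢b x , mergeV a b a≢b y , s) ∷ contractEdges a b a≢b es

-- re-signing on U : Σ becomes Σ Δ δ(U)
resignEdges : ∀ {n} (U : Fin n → Bool) → List (Edge n) → List (Edge n)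
resignEdges U = map (λ { (a , b , s) → (a , b , s xor (U a xor U b)) })

data Step : SGraph → SGraph → Set where
  delEdge    : ∀ {n} (es : List (Edge n)) (i : Fin (length es)) →
               Step (sg n es) (sg n (removeAt es i))
  delVertex  : ∀ {k} (es : List (Edge (suc k))) (v : Fin (suc k)) →
               Step (sg (suc k) es) (sg k (delVertexEdges v es))
  contract   : ∀ {k} (es : List (Edge (suc k))) (a b : Fin (suc k)) (s : Bool)
               (a≢b : a ≢ b) → (a , b , s) ∈ es →
               Step (sg (suc k) es) (sg k (contractEdges a b a≢b es))
  resign     : ∀ {n} (es : List (Edge n)) (U : Fin n → Bool) →
               Step (sg n es) (sg n (resignEdges U es))

Reaches : SGraph → SGraph → Set
Reaches = Star Step

sameEdge : ∀ {n} → Edge n → Fin n → Fin n → Bool → Bool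
sameEdge (a , b , s) u v t =
  ⌊ Data.Bool._≟_ s t ⌋ ∧
  ((⌊ a ≟ u ⌋ ∧ ⌊ b ≟ v ⌋) ∨ (⌊ a ≟ v ⌋ ∧ ⌊ b ≟ u ⌋))

mult : ∀ {n} → List (Edge n) → Fin n → Fin n → Bool → ℕ
mult [] u v t = zero
mult (e ∷ es) u v t with sameEdge e u v t
... | true  = suc (mult es u v t)
... | false = mult es u v t

mapEdge : ∀ {n m} → (Fin n → Fin m) → Edge n → Edge m
mapEdge f (a , b , s) = (f a , f b , s)

Iso : SGraph → SGraph → Set
Iso G H = Σ (Fin (nv G) ↔ Fin (nv H)) λ φ →
  ∀ u v t → mult (map (mapEdge (Inverse.to φ)) (edges G)) u v t ≡ mult (edges H) u v t

HasWeakMinor : SGraph → SGraph → Set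
HasWeakMinor G H = ∃ λ G' → Reaches G G' × Iso G' H

v0 v1 v2 v3 v4 : Fin 5
v0 = zero
v1 = suc zero
v2 = suc (suc zero)
v3 = suc (suc (suc zero))
v4 = suc (suc (suc (suc zero)))

K4edges : Bool → List (Edge 4)
K4edges s =
  (zero , suc zero , s) ∷ (zero , suc (suc zero) , s) ∷ (zero , suc (suc (suc zero)) , s) ∷
  (suc zero , suc (suc zero) , s) ∷ (suc zero , suc (suc (suc zero)) , s) ∷
  (suc (suc zero) , suc (suc (suc zero)) , s) ∷ []

K4e K4o : SGraph
K4e = sg 4 (K4edges false)
K4o = sg 4 (K4edges true)

-- W4: hub v0, rim cycle v1 v2 v3 v4 v1.  W4^o: rim edges v1v2 and v3v4
-- (two nonadjacent rim edges) are odd, all others even.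
W4oEdges : List (Edge 5)
W4oEdges =
  (v1 , v2 , true) ∷ (v2 , v3 , false) ∷ (v3 , v4 , true) ∷ (v4 , v1 , false) ∷
  (v0 , v1 , false) ∷ (v0 , v2 , false) ∷ (v0 , v3 , false) ∷ (v0 , v4 , false) ∷ []

W4o : SGraph
W4o = sg 5 W4oEdges

Adjacent : ∀ {n} → List (Edge n) → Fin n → Fin n → Set
Adjacent es u v = ∃ λ s → (u , v , s) ∈ es ⊎ (v , u , s) ∈ es

W4oPlus : Fin 5 → Fin 5 → Bool → SGraph
W4oPlus u v s = sg 5 ((u , v , s) ∷ W4oEdges)

module Submission where

-- In W₄ (hub v0, rim v1 v2 v3 v4) the only pairs of distinct non-adjacent
-- vertices are the two rim diagonals v1v3 and v2v4, so the extra edge is a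
-- diagonal.  Recall that re-signing preserves the parity of every cycle, and
-- that up to re-signing K₄ᵒ (resp. K₄ᵉ) is the signed K₄ whose triangles are odd
-- (resp. even).
--   * An even diagonal: contracting the spoke to a rim vertex off the
--     diagonal, after deleting the two spokes that would become parallel to
--     rim edges, leaves a K₄ whose four triangles are all odd;
--     re-signing makes every edge odd: K₄ᵒ.
--   * An odd diagonal: re-signing at one end of the diagonal and contracting
--     a rim edge there, after deleting the two edges that would become
--     parallel, leaves a K₄ whose four triangles are all even: K₄ᵉ.

open import Defs
open import Data.Bool using (Bool; true; false; not)
open import Data.Fin using (Fin; #_; _≟_)
open import Data.Fin.Properties using (all?)
open import Data.List using (List; []; _∷_; map; removeAt)
open import Data.List.Membership.Propositional using (_∈_)
open import Data.List.Membership.DecPropositional using () renaming (_∈?_ to member?)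
open import Data.List.Relation.Unary.Any using (here; there)
import Data.Nat as ℕ
import Data.Bool as Bool
open import Data.Product using (_×_; _,_; ∃)
open import Data.Product.Properties using (≡-dec)
open import Data.Sum using (_⊎_; inj₁; inj₂)
open import Data.Unit using (tt)
open import Function using (id)
open import Function.Construct.Identity using (↔-id)
open import Relation.Binary.Construct.Closure.ReflexiveTransitive using (ε; _◅_)
open import Relation.Binary.PropositionalEquality using (_≡_; _≢_; refl)
open import Relation.Nullary using (¬_; Dec; yes; no)
open import Relation.Nullary.Decidable using (True; toWitness; map′; ¬?; _⊎-dec_; _→-dec_)

∀-sign? : {P : Bool → Set} → Dec (P true) → Dec (P false) → Dec (∀ t → P t)
∀-sign? (yes p) (yes q) = yes λ { true → p ; false → q }
∀-sign? (no ¬p) _       = no λ h → ¬p (h true)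
∀-sign? (yes _) (no ¬q) = no λ h → ¬q (h false)

∃-sign? : {P : Bool → Set} → Dec (P true) → Dec (P false) → Dec (∃ P)
∃-sign? p? q? = map′ (λ { (inj₁ p) → true , p ; (inj₂ q) → false , q })
                     (λ { (true , p) → inj₁ p ; (false , q) → inj₂ q })
                     (p? ⊎-dec q?)

sameMultiplicities? : ∀ {n} (es es′ : List (Edge n)) →
                      Dec (∀ u v t → mult es u v t ≡ mult es′ u v t)
sameMultiplicities? es es′ = all? λ u → all? λ v →
  ∀-sign? (mult es u v true ℕ.≟ mult es′ u v true)
          (mult es u v false ℕ.≟ mult es′ u v false)

minorVia : ∀ {G} (H : SGraph) {es : List (Edge (nv H))} → Reaches G (sg (nv H) es) →
           True (sameMultiplicities? (map (mapEdge id) es) (edges H)) →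
           HasWeakMinor G H
minorVia H {es} path agree =
  _ , path , ↔-id _ , toWitness {a? = sameMultiplicities? (map (mapEdge id) es) (edges H)} agree

adjacent? : ∀ {n} (es : List (Edge n)) (u v : Fin n) → Dec (Adjacent es u v)
adjacent? es u v = ∃-sign? (incident true) (incident false)
  where
    _≟ₑ_ : ∀ {n} (e f : Edge n) → Dec (e ≡ f)
    _≟ₑ_ = ≡-dec _≟_ (≡-dec _≟_ Bool._≟_)

    incident : (t : Bool) → Dec ((u , v , t) ∈ es ⊎ (v , u , t) ∈ es)
    incident t = member? _≟ₑ_ (u , v , t) es ⊎-dec member? _≟ₑ_ (v , u , t) es

rimDiagonals : List (Fin 5 × Fin 5)
rimDiagonals = (v1 , v3) ∷ (v3 , v1) ∷ (v2 , v4) ∷ (v4 , v2) ∷ []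

nonAdjacent⇒rimDiagonal : (u v : Fin 5) → u ≢ v → ¬ Adjacent W4oEdges u v →
                          (u , v) ∈ rimDiagonals
nonAdjacent⇒rimDiagonal = toWitness {a? = classification?} tt
  where
    classification? : Dec ((u v : Fin 5) → u ≢ v → ¬ Adjacent W4oEdges u v →
                           (u , v) ∈ rimDiagonals)
    classification? = all? λ u → all? λ v →
      ¬? (u ≟ v) →-dec ¬? (adjacent? W4oEdges u v) →-dec
      member? (≡-dec _≟_ _≟_) (u , v) rimDiagonals

-- Ends of the contracted edges are distinct; these proofs are named because
-- the graphs reached by contraction mention them.
v0≢v1 : v0 ≢ v1
v0≢v1 ()

v0≢v2 : v0 ≢ v2
v0≢v2 ()

v2≢v3 : v2 ≢ v3
v2≢v3 ()

v4≢v1 : v4 ≢ v1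
v4≢v1 ()

-- The re-signing set {a,b} is written  isEnd a b  (and {a} as  isEnd a a).
-- In W₄ᵒ + e the edges sit at the positions
--   0 e, 1 v1v2, 2 v2v3, 3 v3v4, 4 v4v1, 5 v0v1, 6 v0v2, 7 v0v3, 8 v0v4.

-- Even diagonal v1v3: delete the spokes v0v1, v0v3 (they become parallel to
-- v1v2, v2v3), re-sign on {v3,v4} and contract the spoke v0v2.
evenDiagonal13 : (e : Edge 5) →
  Reaches (sg 5 (e ∷ W4oEdges))
          (sg 4 (contractEdges v0 v2 v0≢v2
                  (resignEdges (isEnd v3 v4)
                    (removeAt (removeAt (e ∷ W4oEdges) (# 7)) (# 5)))))
evenDiagonal13 e =
  delEdge _ (# 7) ◅ delEdge _ (# 5) ◅ resign _ (isEnd v3 v4) ◅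
  contract _ v0 v2 false v0≢v2 (there (there (there (there (there (here refl)))))) ◅ ε

-- Even diagonal v2v4: the mirror image under the automorphism (v1 v2)(v3 v4)
-- of W₄ᵒ; delete v0v2, v0v4, re-sign on {v3,v4}, contract the spoke v0v1.
evenDiagonal24 : (e : Edge 5) →
  Reaches (sg 5 (e ∷ W4oEdges))
          (sg 4 (contractEdges v0 v1 v0≢v1
                  (resignEdges (isEnd v3 v4)
                    (removeAt (removeAt (e ∷ W4oEdges) (# 8)) (# 6)))))
evenDiagonal24 e =
  delEdge _ (# 8) ◅ delEdge _ (# 6) ◅ resign _ (isEnd v3 v4) ◅
  contract _ v0 v1 false v0≢v1 (there (there (there (there (there (here refl)))))) ◅ ε

-- Odd diagonal v1v3: re-sign at v1 (the diagonal becomes even), delete the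
-- now odd edges v3v4, v0v1, and contract the (odd) rim edge v4v1.
oddDiagonal13 : (e : Edge 5) →
  Reaches (sg 5 (e ∷ W4oEdges))
          (sg 4 (contractEdges v4 v1 v4≢v1
                  (removeAt (removeAt (resignEdges (isEnd v1 v1) (e ∷ W4oEdges)) (# 5)) (# 3))))
oddDiagonal13 e =
  resign _ (isEnd v1 v1) ◅ delEdge _ (# 5) ◅ delEdge _ (# 3) ◅
  contract _ v4 v1 true v4≢v1 (there (there (there (here refl)))) ◅ ε

-- Odd diagonal v2v4: the mirror image of the previous case; re-sign at v2,
-- delete v3v4, v0v2, and contract the rim edge v2v3.
oddDiagonal24 : (e : Edge 5) →
  Reaches (sg 5 (e ∷ W4oEdges))
          (sg 4 (contractEdges v2 v3 v2≢v3
                  (removeAt (removeAt (resignEdges (isEnd v2 v2) (e ∷ W4oEdges)) (# 6)) (# 3))))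
oddDiagonal24 e =
  resign _ (isEnd v2 v2) ◅ delEdge _ (# 6) ◅ delEdge _ (# 3) ◅
  contract _ v2 v3 true v2≢v3 (there (there (here refl))) ◅ ε

diagonalMinor : ∀ {u v} → (u , v) ∈ rimDiagonals → (s : Bool) →
                HasWeakMinor (W4oPlus u v s) (sg 4 (K4edges (not s)))
diagonalMinor (here refl)                         false = minorVia K4o (evenDiagonal13 (v1 , v3 , false)) tt
diagonalMinor (here refl)                         true  = minorVia K4e (oddDiagonal13 (v1 , v3 , true)) tt
diagonalMinor (there (here refl))                 false = minorVia K4o (evenDiagonal13 (v3 , v1 , false)) tt
diagonalMinor (there (here refl))                 true  = minorVia K4e (oddDiagonal13 (v3 , v1 , true)) tt
diagonalMinor (there (there (here refl)))         false = minorVia K4o (evenDiagonal24 (v2 , v4 , false)) tt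
diagonalMinor (there (there (here refl)))         true  = minorVia K4e (oddDiagonal24 (v2 , v4 , true)) tt
diagonalMinor (there (there (there (here refl)))) false = minorVia K4o (evenDiagonal24 (v4 , v2 , false)) tt
diagonalMinor (there (there (there (here refl)))) true  = minorVia K4e (oddDiagonal24 (v4 , v2 , true)) tt

lemma8 : (u v : Fin 5) → u ≢ v → ¬ Adjacent W4oEdges u v → (s : Bool) →
         HasWeakMinor (W4oPlus u v s) K4o ⊎ HasWeakMinor (W4oPlus u v s) K4e
lemma8 u v u≢v nonAdjacent false =
  inj₁ (diagonalMinor (nonAdjacent⇒rimDiagonal u v u≢v nonAdjacent) false)
lemma8 u v u≢v nonAdjacent true =
  inj₂ (diagonalMinor (nonAdjacent⇒rimDiagonal u v u≢v nonAdjacent) true)
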